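{- Let $k,N$ be positive integers. Let $d\ne d'$ be integers with $d\equiv d'\equiv N\pmod 2$ and $d,d'\in(N/3-N/(48k+15),\,N/3)$, and let $e=(N-d)/2$, $e'=(N-d')/2$. For an integer $D$ of this kind, with $E=(N-D)/2$, define for $i\in[1,D]$ and $j,\ell\in[1,E]$: \[ S_{D,i}=\{i,D+i,\dots,(4k-1)D+i\}\cup\{4kN+4E+i,\ (4k+2)N-i+1\}, \] \[ T_{E,j}=\{4kD+j,\,4kD+E+j,\dots,4kD+(4k-1)E+j\}\cup\{4kN+j,\ 4kN+2E+j\}, \] \[ U_{E,\ell}=\{4kD+4kE+\ell,\,4kD+(4k+1)E+\ell,\dots,4kD+(8k-1)E+\ell\}\cup\{4kN+E+\ell,\ 4kN+3E+\ell\}. \] Let $i\in[1,d]$, $i'\in[1,d']$, $j,\ell\in[1,e]$ and $j',\ell'\in[1,e']$. Then for each $X\in\{S_{d,i},T_{e,j},U_{e,\ell}\}$ and each $Y\in\{S_{d',i'},T_{e',j'},U_{e',\ell'}\}$ we have $|X\cap Y|\le1$, with the single exception that when $X=S_{d,i}$, $Y=S_{d',i'}$ and $i=i'$, we have $S_{d,i}\cap S_{d',i}=\{i,\ (4k+2)N-i+1\}$.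
   Context: $[a,b]$ denotes the set of integers $\{a,a+1,\dots,b\}$. -}

module Defs where

open import Data.Nat using (ℕ; _+_; _*_; _∸_; _/_)
open import Data.List using (List; _∷_; []; map; upTo; _++_)
open import Data.List.Membership.Propositional using (_∈_)
open import Data.Product using (_×_)
open import Relation.Binary.PropositionalEquality using (_≡_)

-- E = (N - D) / 2  (exact division under the lemma's hypotheses)
Ehalf : ℕ → ℕ → ℕ
Ehalf N D = (N ∸ D) / 2

Sset : (k N D i : ℕ) → List ℕ
Sset k N D i =
  map (λ t → t * D + i) (upTo (4 * k))
  ++ (4 * k * N + 4 * Ehalf N D + i) ∷ (((4 * k + 2) * N ∸ i) + 1) ∷ []

Tset : (k N D j : ℕ) → List ℕ
Tset k N D j =
  map (λ t → 4 * k * D + t * Ehalf N D + j) (upTo (4 * k))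
  ++ (4 * k * N + j) ∷ (4 * k * N + 2 * Ehalf N D + j) ∷ []

Uset : (k N D l : ℕ) → List ℕ
Uset k N D l =
  map (λ t → 4 * k * D + (4 * k + t) * Ehalf N D + l) (upTo (4 * k))
  ++ (4 * k * N + Ehalf N D + l) ∷ (4 * k * N + 3 * Ehalf N D + l) ∷ []

data Fam : Set where
  SF TF UF : Fam

pick : (k N D : ℕ) → Fam → (i j l : ℕ) → List ℕ
pick k N D SF i j l = Sset k N D i
pick k N D TF i j l = Tset k N D j
pick k N D UF i j l = Uset k N D l

AtMostOneCommon : List ℕ → List ℕ → Set
AtMostOneCommon X Y = ∀ a b → a ∈ X → a ∈ Y → b ∈ X → b ∈ Y → a ≡ b

-- Take d < d' (the statement is symmetric), so that d' = d + 2s, e = e' + s and N = d + 2e = d' + 2e'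
-- with s > 0 and h = e' - d' ≥ 0; the lower bound on d says (4k+2)(3s+h) < d, so the steps d, d', e,
-- e' are very close to each other. Every set is a progression of 4k terms below M = 4kN followed by
-- two points above M. Two progressions of length n with steps a and a + c, where nc < a, meet at most
-- once; this handles the low parts of S_{d,i} and S_{d',i'}, those of T_{e,j} and S_{d',i'}, and all
-- pairs of T- and U-sets, which lie on progressions of steps e and e' and length 8k+4. In the other
-- pairs the low parts or the high points lie in disjoint intervals. High points of S_{d,i} and
-- S_{d',i'} coincide only as 4kN+4e+i = 4kN+4e'+i', as 4kN+4e+i = (4k+2)N-i'+1, or, when i = i', as the
-- common point (4k+2)N-i+1; in the first two cases 0 < i'-i ≤ 4s, which rules out a common low point
-- td+i = t'd'+i', since td would lie strictly between t'd and (t'+1)d.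

module Submission where

open import Defs
open import Data.Nat
open import Data.Nat.Properties
open import Data.Nat.DivMod using (m≡m%n+[m/n]*n; /-monoˡ-≤; m*n/n≡m)
open import Data.Nat.Tactic.RingSolver using (solve-∀)
open import Algebra.Properties.CommutativeSemigroup +-commutativeSemigroup
  using () renaming (xy∙z≈xz∙y to +-swapʳ)
open import Data.List using (List; []; _∷_; _++_; map; upTo)
open import Data.List.Membership.Propositional using (_∈_; _∉_)
open import Data.List.Membership.Propositional.Properties using (∈-++⁻; ∈-++⁺ˡ; ∈-++⁺ʳ; ∈-map⁺; ∈-upTo⁺)
open import Data.List.Relation.Unary.All as All using (All; []; _∷_; lookup)
open import Data.List.Relation.Unary.All.Properties using (++⁺; map⁺; applyUpTo⁺₁)
open import Data.List.Relation.Unary.Any using (here; there)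
open import Data.List.Relation.Binary.Disjoint.Propositional using (Disjoint)
import Data.List.Relation.Binary.Disjoint.Propositional.Properties as Disjoint
open import Data.Product using (_×_; _,_; ∃-syntax; proj₁; swap)
open import Data.Sum using (_⊎_; inj₁; inj₂)
open import Data.Empty using (⊥; ⊥-elim)
open import Function using (id; _∘_)
open import Function.Bundles using (_⇔_; mk⇔; Equivalence)
open import Relation.Nullary using (¬_; contradiction; yes; no)
open import Relation.Binary.Definitions using (tri<; tri≈; tri>)
open import Relation.Binary.PropositionalEquality

AtMostOneCommon-sym : ∀ {X Y} → AtMostOneCommon X Y → AtMostOneCommon Y X
AtMostOneCommon-sym p a b aY aX bY bX = p a b aX aY bX bY

Disjoint⇒AtMostOneCommon : ∀ {X Y} → Disjoint X Y → AtMostOneCommon X Y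
Disjoint⇒AtMostOneCommon X∩Y=∅ a _ aX aY _ _ = ⊥-elim (X∩Y=∅ (aX , aY))

AtMostOneCommon-pairˡ : ∀ {x y Y} → x ∉ Y → AtMostOneCommon (x ∷ y ∷ []) Y
AtMostOneCommon-pairˡ x∉Y _ _ (here refl) aY _ _ = ⊥-elim (x∉Y aY)
AtMostOneCommon-pairˡ x∉Y _ _ (there _) _ (here refl) bY = ⊥-elim (x∉Y bY)
AtMostOneCommon-pairˡ x∉Y _ _ (there (here refl)) _ (there (here refl)) _ = refl

AtMostOneCommon-pairʳ : ∀ {x y Y} → y ∉ Y → AtMostOneCommon (x ∷ y ∷ []) Y
AtMostOneCommon-pairʳ y∉Y _ _ (there (here refl)) aY _ _ = ⊥-elim (y∉Y aY)
AtMostOneCommon-pairʳ y∉Y _ _ (here _) _ (there (here refl)) bY = ⊥-elim (y∉Y bY)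
AtMostOneCommon-pairʳ y∉Y _ _ (here refl) _ (here refl) _ = refl

separated : ∀ {b A B} → All (_≤ b) A → All (b <_) B → Disjoint A B
separated A≤b b<B (xA , xB) = <⇒≱ (lookup b<B xB) (lookup A≤b xA)

All-map-upTo : ∀ {P : ℕ → Set} {f : ℕ → ℕ} n → (∀ {t} → t < n → P (f t)) → All P (map f (upTo n))
All-map-upTo n Pf = map⁺ (applyUpTo⁺₁ id n Pf)

Layered : ℕ → List ℕ → List ℕ → Set
Layered M L H = All (_≤ M) L × All (M <_) H

∈-layered : ∀ {M LX HX LY HY a} → Layered M LX HX → Layered M LY HY →
  a ∈ LX ++ HX → a ∈ LY ++ HY → (a ∈ LX × a ∈ LY) ⊎ (a ∈ HX × a ∈ HY)
∈-layered {LX = LX} {LY = LY} (LX≤M , M<HX) (LY≤M , M<HY) aX aY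
  with ∈-++⁻ LX aX | ∈-++⁻ LY aY
... | inj₁ aLX | inj₁ aLY = inj₁ (aLX , aLY)
... | inj₂ aHX | inj₂ aHY = inj₂ (aHX , aHY)
... | inj₁ aLX | inj₂ aHY = ⊥-elim (<⇒≱ (lookup M<HY aHY) (lookup LX≤M aLX))
... | inj₂ aHX | inj₁ aLY = ⊥-elim (<⇒≱ (lookup M<HX aHX) (lookup LY≤M aLY))

AtMostOneCommon-++ : ∀ {M LX HX LY HY} → Layered M LX HX → Layered M LY HY →
  AtMostOneCommon LX LY → AtMostOneCommon HX HY →
  (∀ {a b} → a ∈ LX → a ∈ LY → b ∈ HX → b ∈ HY → ⊥) →
  AtMostOneCommon (LX ++ HX) (LY ++ HY)
AtMostOneCommon-++ layX layY low high mixed a b aX aY bX bY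
  with ∈-layered layX layY aX aY | ∈-layered layX layY bX bY
... | inj₁ (aLX , aLY) | inj₁ (bLX , bLY) = low a b aLX aLY bLX bLY
... | inj₂ (aHX , aHY) | inj₂ (bHX , bHY) = high a b aHX aHY bHX bHY
... | inj₁ (aLX , aLY) | inj₂ (bHX , bHY) = ⊥-elim (mixed aLX aLY bHX bHY)
... | inj₂ (aHX , aHY) | inj₁ (bLX , bLY) = ⊥-elim (mixed bLX bLY aHX aHY)

AtMostOneCommon-++-lows : ∀ {M LX HX LY HY} → Layered M LX HX → Layered M LY HY →
  AtMostOneCommon LX LY → Disjoint HX HY → AtMostOneCommon (LX ++ HX) (LY ++ HY)
AtMostOneCommon-++-lows layX layY low highs-disjoint = AtMostOneCommon-++ layX layY low
  (Disjoint⇒AtMostOneCommon highs-disjoint) (λ _ _ bHX bHY → highs-disjoint (bHX , bHY))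

AtMostOneCommon-++-highs : ∀ {M LX HX LY HY} → Layered M LX HX → Layered M LY HY →
  Disjoint LX LY → AtMostOneCommon HX HY → AtMostOneCommon (LX ++ HX) (LY ++ HY)
AtMostOneCommon-++-highs layX layY lows-disjoint high = AtMostOneCommon-++ layX layY
  (Disjoint⇒AtMostOneCommon lows-disjoint) high (λ aLX aLY _ _ → lows-disjoint (aLX , aLY))

OnProgression : (P a n x : ℕ) → Set
OnProgression P a n x = ∃[ t ] t < n × x ≡ P + t * a

OnProgression-widen : ∀ {P a n n' x} → n ≤ n' → OnProgression P a n x → OnProgression P a n' x
OnProgression-widen n≤n' (t , t<n , eq) = t , <-≤-trans t<n n≤n' , eq

OnProgression-≤ : ∀ {P a n x y} → 0 < a → OnProgression P a n x → OnProgression P a n y → x ≤ y →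
  ∃[ m ] m < n × y ≡ x + m * a
OnProgression-≤ {P} {a} {n} a>0 (t , _ , refl) (u , u<n , refl) x≤y
  with m≤n⇒∃[o]m+o≡n (*-cancelʳ-≤ t u a ⦃ >-nonZero a>0 ⦄ (+-cancelˡ-≤ P _ _ x≤y))
... | m , refl = m , ≤-<-trans (m≤n+m m t) u<n , shift P t m
  where
  shift : ∀ P t m → P + (t + m) * a ≡ P + t * a + m * a
  shift P t m = trans (cong (P +_) (*-distribʳ-+ a t m)) (sym (+-assoc P (t * a) (m * a)))

-- Comparing m a = m' (a + c) with m' a: either m = m' = 0, or m > m' and then a ≤ m' c.
multiple-step : ∀ {a c} m m' → 0 < c → m' * c < a → m * a ≡ m' * (a + c) → m ≡ 0
multiple-step {a} {c} m zero c>0 m'c<a eq with m*n≡0⇒m≡0∨n≡0 m eq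
... | inj₁ m≡0 = m≡0
... | inj₂ refl = contradiction m'c<a λ ()
multiple-step {a} {c} m m'@(suc _) c>0 m'c<a eq = contradiction a≤m'c (<⇒≱ m'c<a)
  where
  open ≤-Reasoning
  m*a≡ : m * a ≡ m' * a + m' * c
  m*a≡ = trans eq (*-distribˡ-+ m' a c)
  m'<m : m' < m
  m'<m = *-cancelʳ-< a m' m (begin-strict
    m' * a           <⟨ m<m+n (m' * a) (*-mono-≤ {1} {m'} (s≤s z≤n) c>0) ⟩
    m' * a + m' * c  ≡⟨ sym m*a≡ ⟩
    m * a            ∎)
  a≤m'c : a ≤ m' * c
  a≤m'c = +-cancelˡ-≤ (m' * a) a (m' * c) (begin
    m' * a + a       ≡⟨ +-comm (m' * a) a ⟩
    suc m' * a       ≤⟨ *-monoˡ-≤ a m'<m ⟩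
    m * a            ≡⟨ m*a≡ ⟩
    m' * a + m' * c  ∎)

progressions-meet-once-≤ : ∀ {P Q a c n x y} → 0 < c → n * c < a →
  OnProgression P a n x → OnProgression P a n y →
  OnProgression Q (a + c) n x → OnProgression Q (a + c) n y → x ≤ y → x ≡ y
progressions-meet-once-≤ {a = a} {c} {n} {x} c>0 nc<a xP yP xQ yQ x≤y
  with OnProgression-≤ (≤-<-trans z≤n nc<a) xP yP x≤y
     | OnProgression-≤ (<-≤-trans c>0 (m≤n+m c a)) xQ yQ x≤y
... | m , _ , y≡x+ma | m' , m'<n , y≡x+m'b =
  sym (trans y≡x+ma (trans (cong (λ m → x + m * a) m≡0) (+-identityʳ x)))
  where
  m≡0 : m ≡ 0
  m≡0 = multiple-step m m' c>0 (≤-<-trans (*-monoˡ-≤ c (<⇒≤ m'<n)) nc<a)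
    (+-cancelˡ-≡ x _ _ (trans (sym y≡x+ma) y≡x+m'b))

progressions-AtMostOneCommon : ∀ {P Q a b c n X Y} → b ≡ a + c → 0 < c → n * c < a →
  All (OnProgression P a n) X → All (OnProgression Q b n) Y → AtMostOneCommon X Y
progressions-AtMostOneCommon refl c>0 nc<a onX onY x y xX xY yX yY with ≤-total x y
... | inj₁ x≤y = progressions-meet-once-≤ c>0 nc<a
  (lookup onX xX) (lookup onX yX) (lookup onY xY) (lookup onY yY) x≤y
... | inj₂ y≤x = sym (progressions-meet-once-≤ c>0 nc<a
  (lookup onX yX) (lookup onX xX) (lookup onY yY) (lookup onY xY) y≤x)

m+o≡n⇒m≤n : ∀ {m n} o → m + o ≡ n → m ≤ n
m+o≡n⇒m≤n {m} o refl = m≤m+n m o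

multiples-apart : ∀ {a} t t' {q} → 0 < q → q < a → t * a ≢ t' * a + q
multiples-apart {a} t t' {q} q>0 q<a eq with t ≤? t'
... | yes t≤t' = <⇒≢ (≤-<-trans (*-monoˡ-≤ a t≤t') (m<m+n (t' * a) q>0)) eq
... | no t≰t' = <⇒≢ (begin-strict
  t' * a + q  <⟨ +-monoʳ-< (t' * a) q<a ⟩
  t' * a + a  ≡⟨ +-comm (t' * a) a ⟩
  suc t' * a  ≤⟨ *-monoˡ-≤ a (≰⇒> t≰t') ⟩
  t * a       ∎) (sym eq)
  where open ≤-Reasoning

same-parity⇒+2* : ∀ {a b} → a % 2 ≡ b % 2 → a ≤ b → ∃[ c ] b ≡ a + 2 * c
same-parity⇒+2* {a} {b} a≡b a≤b with m≤n⇒∃[o]m+o≡n (/-monoˡ-≤ 2 a≤b)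
... | c , a/2+c≡b/2 = c , (begin
  b                            ≡⟨ m≡m%n+[m/n]*n b 2 ⟩
  b % 2 + b / 2 * 2            ≡⟨ cong₂ (λ r q → r + q * 2) (sym a≡b) (sym a/2+c≡b/2) ⟩
  a % 2 + (a / 2 + c) * 2      ≡⟨ regroup (a % 2) (a / 2) c ⟩
  a % 2 + a / 2 * 2 + 2 * c    ≡⟨ cong (_+ 2 * c) (sym (m≡m%n+[m/n]*n a 2)) ⟩
  a + 2 * c                    ∎)
  where
  open ≡-Reasoning
  regroup : ∀ r q c → r + (q + c) * 2 ≡ r + q * 2 + 2 * c
  regroup = solve-∀

Ehalf-exact : ∀ {N} D E → N ≡ D + 2 * E → Ehalf N D ≡ E
Ehalf-exact D E refl = begin
  (D + 2 * E ∸ D) / 2  ≡⟨ cong (_/ 2) (m+n∸m≡n D (2 * E)) ⟩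
  2 * E / 2            ≡⟨ cong (_/ 2) (*-comm 2 E) ⟩
  E * 2 / 2            ≡⟨ m*n/n≡m E 2 ⟩
  E                    ∎
  where open ≡-Reasoning

-- Writing N = 3d + 2δ, the hypothesis N/3 - N/(48k+15) < d becomes 2δ(48k+12) < 9d.
lower-bound⇒ : ∀ k d δ → (3 * d + 2 * δ) * (48 * k + 12) < 3 * d * (48 * k + 15) →
  (4 * k + 2) * δ < d
lower-bound⇒ k d δ lower = *-cancelˡ-< 9 _ _ (begin-strict
  9 * ((4 * k + 2) * δ)                      ≤⟨ m≤m+n _ ((60 * k + 6) * δ) ⟩
  9 * ((4 * k + 2) * δ) + (60 * k + 6) * δ   ≡⟨ regroup k δ ⟩
  2 * δ * (48 * k + 12)                      <⟨ +-cancelˡ-< (3 * d * (48 * k + 12)) _ _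
                                                   (subst₂ _<_ (expandˡ k d δ) (expandʳ k d) lower) ⟩
  9 * d                                      ∎)
  where
  open ≤-Reasoning
  regroup : ∀ k δ → 9 * ((4 * k + 2) * δ) + (60 * k + 6) * δ ≡ 2 * δ * (48 * k + 12)
  regroup = solve-∀
  expandˡ : ∀ k d δ → (3 * d + 2 * δ) * (48 * k + 12) ≡ 3 * d * (48 * k + 12) + 2 * δ * (48 * k + 12)
  expandˡ = solve-∀
  expandʳ : ∀ k d → 3 * d * (48 * k + 15) ≡ 3 * d * (48 * k + 12) + 9 * d
  expandʳ = solve-∀

module Blocks (k N D E : ℕ) where

  M : ℕ
  M = 4 * k * N

  mirror : ℕ → ℕ
  mirror i = (4 * k + 2) * N ∸ i + 1

  S-low S-high T-low T-high U-low U-high : ℕ → List ℕ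
  S-low i  = map (λ t → t * D + i) (upTo (4 * k))
  S-high i = M + 4 * E + i ∷ mirror i ∷ []
  T-low j  = map (λ t → 4 * k * D + t * E + j) (upTo (4 * k))
  T-high j = M + j ∷ M + 2 * E + j ∷ []
  U-low l  = map (λ t → 4 * k * D + (4 * k + t) * E + l) (upTo (4 * k))
  U-high l = M + E + l ∷ M + 3 * E + l ∷ []

  S T U : ℕ → List ℕ
  S i = S-low i ++ S-high i
  T j = T-low j ++ T-high j
  U l = U-low l ++ U-high l

  member : Fam → (i j l : ℕ) → List ℕ
  member SF i j l = S i
  member TF i j l = T j
  member UF i j l = U l

  mirror+i : ∀ {i} → i ≤ (4 * k + 2) * N → mirror i + i ≡ (4 * k + 2) * N + 1
  mirror+i {i} i≤top = begin
    top ∸ i + 1 + i    ≡⟨ +-assoc (top ∸ i) 1 i ⟩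
    top ∸ i + (1 + i)  ≡⟨ cong (top ∸ i +_) (+-comm 1 i) ⟩
    top ∸ i + (i + 1)  ≡⟨ sym (+-assoc (top ∸ i) i 1) ⟩
    top ∸ i + i + 1    ≡⟨ cong (_+ 1) (m∸n+n≡m i≤top) ⟩
    top + 1            ∎
    where
    open ≡-Reasoning
    top = (4 * k + 2) * N

  mirror-injective : ∀ {i i'} → i ≤ (4 * k + 2) * N → i' ≤ (4 * k + 2) * N → mirror i ≡ mirror i' → i ≡ i'
  mirror-injective {i} {i'} i≤top i'≤top eq = +-cancelˡ-≡ (mirror i) i i'
    (trans (mirror+i i≤top) (trans (sym (mirror+i i'≤top)) (cong (_+ i') (sym eq))))

pick≡member : ∀ {k N D E} f i j l → Ehalf N D ≡ E → pick k N D f i j l ≡ Blocks.member k N D E f i j l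
pick≡member SF i j l refl = refl
pick≡member TF i j l refl = refl
pick≡member UF i j l refl = refl

module Design (k N D E : ℕ) (N≡ : N ≡ D + 2 * E) where

  open Blocks k N D E public

  M≡ : M ≡ 4 * k * D + 8 * k * E
  M≡ = trans (cong (4 * k *_) N≡) (expand k D E)
    where
    expand : ∀ k D E → 4 * k * (D + 2 * E) ≡ 4 * k * D + 8 * k * E
    expand = solve-∀

  top≡ : (4 * k + 2) * N ≡ M + 4 * E + 2 * D
  top≡ = trans (split k N) (trans (cong (λ n → M + 2 * n) N≡) (regroup M D E))
    where
    split : ∀ k N → (4 * k + 2) * N ≡ 4 * k * N + 2 * N
    split = solve-∀
    regroup : ∀ M D E → M + 2 * (D + 2 * E) ≡ M + 4 * E + 2 * D
    regroup = solve-∀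

  4kD≤M : 4 * k * D ≤ M
  4kD≤M = m+o≡n⇒m≤n (8 * k * E) (sym M≡)

  ≤D⇒≤top : ∀ {i} → i ≤ D → i ≤ (4 * k + 2) * N
  ≤D⇒≤top {i} i≤D = subst (i ≤_) (sym top≡)
    (≤-trans i≤D (≤-trans (m≤m+n D (D + 0)) (m≤n+m (2 * D) (M + 4 * E))))

  mirror+i≡ : ∀ {i} → i ≤ D → mirror i + i ≡ M + 4 * E + 2 * D + 1
  mirror+i≡ i≤D = trans (mirror+i (≤D⇒≤top i≤D)) (cong (_+ 1) top≡)

  M+4E+D<mirror : ∀ {i} → i ≤ D → M + 4 * E + D < mirror i
  M+4E+D<mirror {i} i≤D = +-cancelʳ-< i _ _ (begin-strict
    M + 4 * E + D + i      ≤⟨ +-monoʳ-≤ (M + 4 * E + D) i≤D ⟩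
    M + 4 * E + D + D      ≡⟨ regroup M E D ⟩
    M + 4 * E + 2 * D      <⟨ m<m+n _ (s≤s z≤n) ⟩
    M + 4 * E + 2 * D + 1  ≡⟨ sym (mirror+i≡ i≤D) ⟩
    mirror i + i           ∎)
    where
    open ≤-Reasoning
    regroup : ∀ M E D → M + 4 * E + D + D ≡ M + 4 * E + 2 * D
    regroup = solve-∀

  4k+t<8k : ∀ {t} → t < 4 * k → 4 * k + t < 8 * k
  4k+t<8k {t} t<4k = subst (4 * k + t <_) (double k) (+-monoʳ-< (4 * k) t<4k)
    where
    double : ∀ k → 4 * k + 4 * k ≡ 8 * k
    double = solve-∀

  a+tE+x≤a+[1+t]E : ∀ a t {x} → x ≤ E → a + t * E + x ≤ a + (1 + t) * E
  a+tE+x≤a+[1+t]E a t {x} x≤E = begin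
    a + t * E + x  ≤⟨ +-monoʳ-≤ (a + t * E) x≤E ⟩
    a + t * E + E  ≡⟨ regroup a t E ⟩
    a + (1 + t) * E ∎
    where
    open ≤-Reasoning
    regroup : ∀ a t E → a + t * E + E ≡ a + (1 + t) * E
    regroup = solve-∀

  S-low-≤ : ∀ {i b} → i ≤ D → 4 * k * D ≤ b → All (_≤ b) (S-low i)
  S-low-≤ {i} i≤D 4kD≤b = All-map-upTo (4 * k) λ {t} t<4k → ≤-trans (begin
    t * D + i   ≤⟨ +-monoʳ-≤ (t * D) i≤D ⟩
    t * D + D   ≡⟨ +-comm (t * D) D ⟩
    suc t * D   ≤⟨ *-monoˡ-≤ D t<4k ⟩
    4 * k * D   ∎) 4kD≤b
    where open ≤-Reasoning

  S-high-> : ∀ {i b} → 1 ≤ i → i ≤ D → b ≤ M + 4 * E → All (b <_) (S-high i)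
  S-high-> 1≤i i≤D b≤ =
    ≤-<-trans b≤ (m<m+n _ 1≤i) ∷ ≤-<-trans b≤ (≤-<-trans (m≤m+n _ D) (M+4E+D<mirror i≤D)) ∷ []

  T-low-> : ∀ {j b} → 1 ≤ j → b ≤ 4 * k * D → All (b <_) (T-low j)
  T-low-> 1≤j b≤ = All-map-upTo (4 * k) λ {t} _ →
    ≤-<-trans (≤-trans b≤ (m≤m+n _ (t * E))) (m<m+n _ 1≤j)

  T-low-≤ : ∀ {j} → j ≤ E → All (_≤ M) (T-low j)
  T-low-≤ j≤E = All-map-upTo (4 * k) λ {t} t<4k → begin
    4 * k * D + t * E + _      ≤⟨ a+tE+x≤a+[1+t]E (4 * k * D) t j≤E ⟩
    4 * k * D + (1 + t) * E    ≤⟨ +-monoʳ-≤ (4 * k * D) (*-monoˡ-≤ E (≤-trans t<4k 4k≤8k)) ⟩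
    4 * k * D + 8 * k * E      ≡⟨ sym M≡ ⟩
    M                          ∎
    where
    open ≤-Reasoning
    4k≤8k : 4 * k ≤ 8 * k
    4k≤8k = *-monoˡ-≤ k (m≤m+n 4 4)

  T-high-> : ∀ {j} → 1 ≤ j → All (M <_) (T-high j)
  T-high-> 1≤j = m<m+n M 1≤j ∷ ≤-<-trans (m≤m+n M _) (m<m+n _ 1≤j) ∷ []

  T-high-≤ : ∀ {j b} → j ≤ E → M + 3 * E ≤ b → All (_≤ b) (T-high j)
  T-high-≤ {j} j≤E ≤b =
    ≤-trans (+-monoʳ-≤ M (≤-trans j≤E (m≤m+n E _))) ≤b ∷ ≤-trans (a+tE+x≤a+[1+t]E M 2 j≤E) ≤b ∷ []

  U-low-> : ∀ {l b} → 1 ≤ l → b ≤ 4 * k * D + 4 * k * E → All (b <_) (U-low l)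
  U-low-> 1≤l b≤ = All-map-upTo (4 * k) λ {t} _ →
    ≤-<-trans (≤-trans b≤ (+-monoʳ-≤ (4 * k * D) (*-monoˡ-≤ E (m≤m+n (4 * k) t)))) (m<m+n _ 1≤l)

  U-low-≤ : ∀ {l} → l ≤ E → All (_≤ M) (U-low l)
  U-low-≤ l≤E = All-map-upTo (4 * k) λ {t} t<4k → begin
    4 * k * D + (4 * k + t) * E + _      ≤⟨ a+tE+x≤a+[1+t]E (4 * k * D) (4 * k + t) l≤E ⟩
    4 * k * D + (1 + (4 * k + t)) * E    ≤⟨ +-monoʳ-≤ (4 * k * D) (*-monoˡ-≤ E (4k+t<8k t<4k)) ⟩
    4 * k * D + 8 * k * E                ≡⟨ sym M≡ ⟩
    M                                    ∎
    where open ≤-Reasoning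

  U-high-> : ∀ {l} → 1 ≤ l → All (M <_) (U-high l)
  U-high-> 1≤l = ≤-<-trans (m≤m+n M _) (m<m+n _ 1≤l) ∷ ≤-<-trans (m≤m+n M _) (m<m+n _ 1≤l) ∷ []

  U₁-≤ : ∀ {l} → l ≤ E → M + E + l ≤ M + 2 * E
  U₁-≤ {l} l≤E = subst (M + E + l ≤_) (regroup M E) (+-monoʳ-≤ (M + E) l≤E)
    where
    regroup : ∀ M E → M + E + E ≡ M + 2 * E
    regroup = solve-∀

  U-high-≤ : ∀ {l b} → l ≤ E → M + 4 * E ≤ b → All (_≤ b) (U-high l)
  U-high-≤ l≤E ≤b =
    ≤-trans (U₁-≤ l≤E) (≤-trans (+-monoʳ-≤ M (*-monoˡ-≤ E (m≤m+n 2 2))) ≤b)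
    ∷ ≤-trans (a+tE+x≤a+[1+t]E M 3 l≤E) ≤b ∷ []

  S-layered : ∀ {i} → 1 ≤ i → i ≤ D → Layered M (S-low i) (S-high i)
  S-layered 1≤i i≤D = S-low-≤ i≤D 4kD≤M , S-high-> 1≤i i≤D (m≤m+n M (4 * E))

  T-layered : ∀ {j} → 1 ≤ j → j ≤ E → Layered M (T-low j) (T-high j)
  T-layered 1≤j j≤E = T-low-≤ j≤E , T-high-> 1≤j

  U-layered : ∀ {l} → 1 ≤ l → l ≤ E → Layered M (U-low l) (U-high l)
  U-layered 1≤l l≤E = U-low-≤ l≤E , U-high-> 1≤l

  S-low-progression : ∀ {i} → All (OnProgression i D (4 * k)) (S-low i)
  S-low-progression {i} = All-map-upTo (4 * k) λ {t} t<4k → t , t<4k , +-comm (t * D) i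

  T-low-progression : ∀ {j} → All (OnProgression (4 * k * D + j) E (4 * k)) (T-low j)
  T-low-progression {j} = All-map-upTo (4 * k) λ {t} t<4k → t , t<4k , +-swapʳ (4 * k * D) (t * E) j

  4k≤8k+4 : 4 * k ≤ 8 * k + 4
  4k≤8k+4 = m+o≡n⇒m≤n (4 * k + 4) (regroup k)
    where
    regroup : ∀ k → 4 * k + (4 * k + 4) ≡ 8 * k + 4
    regroup = solve-∀

  T-progression : ∀ {j} → All (OnProgression (4 * k * D + j) E (8 * k + 4)) (T j)
  T-progression {j} = ++⁺ (All.map (OnProgression-widen 4k≤8k+4) T-low-progression)
    ( (8 * k , m<m+n (8 * k) (s≤s z≤n) , trans (cong (_+ j) M≡) (regroup₀ k D E j))
    ∷ (8 * k + 2 , +-monoʳ-< (8 * k) (s≤s (s≤s (s≤s z≤n))) ,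
        trans (cong (λ m → m + 2 * E + j) M≡) (regroup₂ k D E j))
    ∷ [])
    where
    regroup₀ : ∀ k D E j → 4 * k * D + 8 * k * E + j ≡ 4 * k * D + j + 8 * k * E
    regroup₀ = solve-∀
    regroup₂ : ∀ k D E j → 4 * k * D + 8 * k * E + 2 * E + j ≡ 4 * k * D + j + (8 * k + 2) * E
    regroup₂ = solve-∀

  U-progression : ∀ {l} → All (OnProgression (4 * k * D + l) E (8 * k + 4)) (U l)
  U-progression {l} = ++⁺
    (All-map-upTo (4 * k) λ {t} t<4k →
      4 * k + t , <-≤-trans (4k+t<8k t<4k) (m≤m+n (8 * k) 4) , +-swapʳ (4 * k * D) ((4 * k + t) * E) l)
    ( (8 * k + 1 , +-monoʳ-< (8 * k) (s≤s (s≤s z≤n)) ,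
        trans (cong (λ m → m + E + l) M≡) (regroup₁ k D E l))
    ∷ (8 * k + 3 , +-monoʳ-< (8 * k) (s≤s (s≤s (s≤s (s≤s z≤n)))) ,
        trans (cong (λ m → m + 3 * E + l) M≡) (regroup₃ k D E l))
    ∷ [])
    where
    regroup₁ : ∀ k D E l → 4 * k * D + 8 * k * E + E + l ≡ 4 * k * D + l + (8 * k + 1) * E
    regroup₁ = solve-∀
    regroup₃ : ∀ k D E l → 4 * k * D + 8 * k * E + 3 * E + l ≡ 4 * k * D + l + (8 * k + 3) * E
    regroup₃ = solve-∀

Conclusion : (k N d d' i i' j l j' l' : ℕ) → Set
Conclusion k N d d' i i' j l j' l' =
  ((f g : Fam) → ¬ (f ≡ SF × g ≡ SF × i ≡ i') →
    AtMostOneCommon (pick k N d f i j l) (pick k N d' g i' j' l'))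
  × (i ≡ i' → (a : ℕ) →
    ((a ∈ Sset k N d i × a ∈ Sset k N d' i) ⇔ (a ≡ i ⊎ a ≡ ((4 * k + 2) * N ∸ i) + 1)))

Conclusion-swap : ∀ {k N d d' i i' j l j' l'} →
  Conclusion k N d' d i' i j' l' j l → Conclusion k N d d' i i' j l j' l'
Conclusion-swap (separate , common) =
  (λ f g ¬same → AtMostOneCommon-sym (separate g f λ (g≡ , f≡ , i'≡i) → ¬same (f≡ , g≡ , sym i'≡i))) ,
  λ { refl a → mk⇔ (Equivalence.to (common refl a) ∘ swap) (swap ∘ Equivalence.from (common refl a)) }

module TwoDesigns (k d s h : ℕ) (k>0 : 0 < k) (s>0 : 0 < s) (small : (4 * k + 2) * (3 * s + h) < d) where

  d' e' e N : ℕ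
  d' = d + 2 * s
  e' = d' + h
  e = e' + s
  N = d' + 2 * e'

  N≡d+2e : N ≡ d + 2 * e
  N≡d+2e = regroup d s h
    where
    regroup : ∀ d s h → d + 2 * s + 2 * (d + 2 * s + h) ≡ d + 2 * (d + 2 * s + h + s)
    regroup = solve-∀

  module X = Design k N d e N≡d+2e
  module Y = Design k N d' e' refl
  open X using (M; mirror)

  s-small : (8 * k + 4) * s < d
  s-small = ≤-<-trans (m+o≡n⇒m≤n _ (regroup k s h)) small
    where
    regroup : ∀ k s h → (8 * k + 4) * s + ((4 * k + 2) * s + (4 * k + 2) * h) ≡ (4 * k + 2) * (3 * s + h)
    regroup = solve-∀

  sh-small : 4 * k * (s + h) < d
  sh-small = ≤-<-trans (m+o≡n⇒m≤n _ (regroup k s h)) small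
    where
    regroup : ∀ k s h → 4 * k * (s + h) + (8 * k * s + 6 * s + 2 * h) ≡ (4 * k + 2) * (3 * s + h)
    regroup = solve-∀

  d≤d' : d ≤ d'
  d≤d' = m≤m+n d (2 * s)

  d≤e' : d ≤ e'
  d≤e' = ≤-trans d≤d' (m≤m+n d' h)

  4s≤d : 4 * s ≤ d
  4s≤d = ≤-trans (*-monoˡ-≤ s (m≤n+m 4 (8 * k))) (<⇒≤ s-small)

  4s≤e' : 4 * s ≤ e'
  4s≤e' = ≤-trans 4s≤d d≤e'

  3e≤4e' : 3 * e ≤ 4 * e'
  3e≤4e' = begin
    3 * e             ≡⟨ *-distribˡ-+ 3 e' s ⟩
    3 * e' + 3 * s    ≤⟨ +-monoʳ-≤ (3 * e') (≤-trans (*-monoˡ-≤ s (m≤n+m 3 1)) 4s≤e') ⟩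
    3 * e' + e'       ≡⟨ +-comm (3 * e') e' ⟩
    4 * e'            ∎
    where open ≤-Reasoning

  4kd'≤4kd+4ke : 4 * k * d' ≤ 4 * k * d + 4 * k * e
  4kd'≤4kd+4ke = subst (4 * k * d' ≤_) (*-distribˡ-+ (4 * k) d e)
    (*-monoʳ-≤ (4 * k) (+-monoʳ-≤ d (≤-trans (*-monoˡ-≤ s (m≤n+m 2 2)) (≤-trans 4s≤e' (m≤m+n e' s)))))

  M+4e'+d'≤M+4e+d : M + 4 * e' + d' ≤ M + 4 * e + d
  M+4e'+d'≤M+4e+d = m+o≡n⇒m≤n (2 * s) (regroup M d s h)
    where
    regroup : ∀ M d s h → M + 4 * (d + 2 * s + h) + (d + 2 * s) + 2 * s ≡ M + 4 * (d + 2 * s + h + s) + d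
    regroup = solve-∀

  mirror∉Y-S-high : ∀ {i i'} → i ≤ d → i' ≤ d' → i ≢ i' → mirror i ∉ Y.S-high i'
  mirror∉Y-S-high {i} {i'} i≤d i'≤d' _ (here eq) = <⇒≢ (begin-strict
    M + 4 * e' + i'  ≤⟨ +-monoʳ-≤ (M + 4 * e') i'≤d' ⟩
    M + 4 * e' + d'  ≤⟨ M+4e'+d'≤M+4e+d ⟩
    M + 4 * e + d    <⟨ X.M+4E+D<mirror i≤d ⟩
    mirror i         ∎) (sym eq)
    where open ≤-Reasoning
  mirror∉Y-S-high i≤d i'≤d' i≢i' (there (here eq)) =
    i≢i' (X.mirror-injective (X.≤D⇒≤top i≤d) (Y.≤D⇒≤top i'≤d') eq)

  M+4e+i≡mirror⇒ : ∀ {i i'} → i ≤ d → i' ≤ d' → M + 4 * e + i ≡ mirror i' → i < i' × i' ≤ i + 4 * s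
  M+4e+i≡mirror⇒ {i} {i'} i≤d i'≤d' eq = i<i' , <⇒≤ i'<i+4s
    where
    open ≤-Reasoning
    sum : i + i' ≡ 2 * d + 1
    sum = +-cancelˡ-≡ (M + 4 * e) _ _ (begin-equality
      M + 4 * e + (i + i')    ≡⟨ sym (+-assoc (M + 4 * e) i i') ⟩
      M + 4 * e + i + i'      ≡⟨ cong (_+ i') eq ⟩
      mirror i' + i'          ≡⟨ Y.mirror+i≡ i'≤d' ⟩
      M + 4 * e' + 2 * d' + 1 ≡⟨ regroup M d s h ⟩
      M + 4 * e + (2 * d + 1) ∎)
      where
      regroup : ∀ M d s h → M + 4 * (d + 2 * s + h) + 2 * (d + 2 * s) + 1 ≡ M + 4 * (d + 2 * s + h + s) + (2 * d + 1)
      regroup = solve-∀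
    i<i' : i < i'
    i<i' = +-cancelˡ-< i i i' (begin-strict
      i + i      ≤⟨ +-mono-≤ i≤d i≤d ⟩
      d + d      ≡⟨ cong (d +_) (sym (+-identityʳ d)) ⟩
      2 * d      <⟨ m<m+n (2 * d) (s≤s z≤n) ⟩
      2 * d + 1  ≡⟨ sym sum ⟩
      i + i'     ∎)
    i'<i+4s : i' < i + 4 * s
    i'<i+4s = +-cancelˡ-< i' i' (i + 4 * s) (begin-strict
      i' + i'              ≤⟨ +-mono-≤ i'≤d' i'≤d' ⟩
      d' + d'              ≡⟨ regroup d s ⟩
      2 * d + 4 * s        <⟨ +-monoˡ-< (4 * s) (m<m+n (2 * d) (s≤s z≤n)) ⟩
      2 * d + 1 + 4 * s    ≡⟨ cong (_+ 4 * s) (sym sum) ⟩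
      i + i' + 4 * s       ≡⟨ cong (_+ 4 * s) (+-comm i i') ⟩
      i' + i + 4 * s       ≡⟨ +-assoc i' i (4 * s) ⟩
      i' + (i + 4 * s)     ∎)
      where
      regroup : ∀ d s → d + 2 * s + (d + 2 * s) ≡ 2 * d + 4 * s
      regroup = solve-∀

  M+4e+i∈Y-S-high⇒ : ∀ {i i'} → i ≤ d → i' ≤ d' → M + 4 * e + i ∈ Y.S-high i' → i < i' × i' ≤ i + 4 * s
  M+4e+i∈Y-S-high⇒ {i} {i'} _ _ (here eq) =
    subst (λ x → i < x × x ≤ i + 4 * s) (sym i'≡) (m<m+n i (≤-trans (s≤s z≤n) (*-monoʳ-≤ 4 s>0)) , ≤-refl)
    where
    regroup : ∀ M d s h i → M + 4 * (d + 2 * s + h + s) + i ≡ M + 4 * (d + 2 * s + h) + (i + 4 * s)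
    regroup = solve-∀
    i'≡ : i' ≡ i + 4 * s
    i'≡ = +-cancelˡ-≡ (M + 4 * e') i' (i + 4 * s) (trans (sym eq) (regroup M d s h i))
  M+4e+i∈Y-S-high⇒ i≤d i'≤d' (there (here eq)) = M+4e+i≡mirror⇒ i≤d i'≤d' eq

  shifted-S-lows-disjoint : ∀ {i i' t t'} → t' < 4 * k → i < i' → i' ≤ i + 4 * s → i + t * d ≢ i' + t' * d'
  shifted-S-lows-disjoint {i} {t = t} {t'} t'<4k i<i' i'≤i+4s eq with m≤n⇒∃[o]m+o≡n i<i'
  ... | o , refl = multiples-apart t t' (≤-trans (s≤s z≤n) (m≤n+m (1 + o) (2 * (t' * s)))) gap<d
    (+-cancelˡ-≡ i _ _ (trans eq (regroup i o t' d s)))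
    where
    open ≤-Reasoning
    regroup : ∀ i o t' d s → 1 + i + o + t' * (d + 2 * s) ≡ i + (t' * d + (2 * (t' * s) + (1 + o)))
    regroup = solve-∀
    1+o≤4s : 1 + o ≤ 4 * s
    1+o≤4s = +-cancelˡ-≤ i (1 + o) (4 * s) (subst (_≤ i + 4 * s) (sym (+-suc i o)) i'≤i+4s)
    gap<d : 2 * (t' * s) + (1 + o) < d
    gap<d = begin-strict
      2 * (t' * s) + (1 + o)        ≤⟨ +-mono-≤ (*-monoʳ-≤ 2 (*-monoˡ-≤ s (<⇒≤ t'<4k))) 1+o≤4s ⟩
      2 * (4 * k * s) + 4 * s       ≡⟨ regroup′ k s ⟩
      (8 * k + 4) * s               <⟨ s-small ⟩
      d                             ∎
      where
      regroup′ : ∀ k s → 2 * (4 * k * s) + 4 * s ≡ (8 * k + 4) * s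
      regroup′ = solve-∀

  S-lows : ∀ {i i'} → AtMostOneCommon (X.S-low i) (Y.S-low i')
  S-lows = progressions-AtMostOneCommon refl (≤-trans s>0 (m≤m+n s (s + 0)))
    (≤-<-trans (m+o≡n⇒m≤n (4 * s) (regroup k s)) s-small) X.S-low-progression Y.S-low-progression
    where
    regroup : ∀ k s → 4 * k * (2 * s) + 4 * s ≡ (8 * k + 4) * s
    regroup = solve-∀

  S-S : ∀ {i i'} → 1 ≤ i → i ≤ d → 1 ≤ i' → i' ≤ d' → i ≢ i' → AtMostOneCommon (X.S i) (Y.S i')
  S-S {i} {i'} 1≤i i≤d 1≤i' i'≤d' i≢i' = AtMostOneCommon-++ (X.S-layered 1≤i i≤d) (Y.S-layered 1≤i' i'≤d')
    S-lows (AtMostOneCommon-pairʳ (mirror∉Y-S-high i≤d i'≤d' i≢i')) mixed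
    where
    mixed : ∀ {a b} → a ∈ X.S-low i → a ∈ Y.S-low i' → b ∈ X.S-high i → b ∈ Y.S-high i' → ⊥
    mixed aX aY (here refl) bY
      with lookup X.S-low-progression aX | lookup Y.S-low-progression aY | M+4e+i∈Y-S-high⇒ i≤d i'≤d' bY
    ... | t , _ , a≡ | _ , t'<4k , a≡′ | i<i' , i'≤i+4s =
      shifted-S-lows-disjoint {t = t} t'<4k i<i' i'≤i+4s (trans (sym a≡) a≡′)
    mixed _ _ (there (here refl)) bY = mirror∉Y-S-high i≤d i'≤d' i≢i' bY

  S-S-common : ∀ {i a} → 1 ≤ i → i ≤ d → (a ∈ X.S i × a ∈ Y.S i) ⇔ (a ≡ i ⊎ a ≡ mirror i)
  S-S-common {i} {a} 1≤i i≤d = mk⇔ to from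
    where
    i≤d' : i ≤ d'
    i≤d' = ≤-trans i≤d d≤d'
    0<4k : 0 < 4 * k
    0<4k = ≤-trans (s≤s z≤n) (*-monoʳ-≤ 4 k>0)
    i∈X : i ∈ X.S-low i
    i∈X = ∈-map⁺ _ (∈-upTo⁺ 0<4k)
    i∈Y : i ∈ Y.S-low i
    i∈Y = ∈-map⁺ _ (∈-upTo⁺ 0<4k)
    common-side : (a ∈ X.S-low i × a ∈ Y.S-low i) ⊎ (a ∈ X.S-high i × a ∈ Y.S-high i) → a ≡ i ⊎ a ≡ mirror i
    common-side (inj₁ (aLX , aLY)) = inj₁ (S-lows a i aLX aLY i∈X i∈Y)
    common-side (inj₂ (here a≡ , aHY)) =
      contradiction (proj₁ (M+4e+i∈Y-S-high⇒ i≤d i≤d' (subst (_∈ Y.S-high i) a≡ aHY))) (<-irrefl refl)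
    common-side (inj₂ (there (here a≡) , _)) = inj₂ a≡
    to : a ∈ X.S i × a ∈ Y.S i → a ≡ i ⊎ a ≡ mirror i
    to (aX , aY) = common-side (∈-layered (X.S-layered 1≤i i≤d) (Y.S-layered 1≤i i≤d') aX aY)
    from : a ≡ i ⊎ a ≡ mirror i → a ∈ X.S i × a ∈ Y.S i
    from (inj₁ refl) = ∈-++⁺ˡ i∈X , ∈-++⁺ˡ i∈Y
    from (inj₂ refl) = ∈-++⁺ʳ (X.S-low i) (there (here refl)) , ∈-++⁺ʳ (Y.S-low i) (there (here refl))

  S-T : ∀ {i j'} → 1 ≤ i → i ≤ d → 1 ≤ j' → j' ≤ e' → AtMostOneCommon (X.S i) (Y.T j')
  S-T 1≤i i≤d 1≤j' j'≤e' = AtMostOneCommon-++-highs (X.S-layered 1≤i i≤d) (Y.T-layered 1≤j' j'≤e')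
    (separated (X.S-low-≤ i≤d (*-monoʳ-≤ (4 * k) d≤d')) (Y.T-low-> 1≤j' ≤-refl))
    (Disjoint⇒AtMostOneCommon (Disjoint.sym
      (separated (Y.T-high-≤ j'≤e' (+-monoʳ-≤ M (≤-trans (*-monoˡ-≤ e' (m≤n+m 3 1)) (*-monoʳ-≤ 4 (m≤m+n e' s)))))
                 (X.S-high-> 1≤i i≤d ≤-refl))))

  S-U : ∀ {i l'} → 1 ≤ i → i ≤ d → 1 ≤ l' → l' ≤ e' → AtMostOneCommon (X.S i) (Y.U l')
  S-U 1≤i i≤d 1≤l' l'≤e' = AtMostOneCommon-++-highs (X.S-layered 1≤i i≤d) (Y.U-layered 1≤l' l'≤e')
    (separated (X.S-low-≤ i≤d (*-monoʳ-≤ (4 * k) d≤d')) (Y.U-low-> 1≤l' (m≤m+n _ _)))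
    (Disjoint⇒AtMostOneCommon (Disjoint.sym
      (separated (Y.U-high-≤ l'≤e' (+-monoʳ-≤ M (*-monoʳ-≤ 4 (m≤m+n e' s)))) (X.S-high-> 1≤i i≤d ≤-refl))))

  T-S : ∀ {j i'} → 1 ≤ j → j ≤ e → 1 ≤ i' → i' ≤ d' → AtMostOneCommon (X.T j) (Y.S i')
  T-S 1≤j j≤e 1≤i' i'≤d' = AtMostOneCommon-++-lows (X.T-layered 1≤j j≤e) (Y.S-layered 1≤i' i'≤d')
    (AtMostOneCommon-sym (progressions-AtMostOneCommon (regroup d s h) (≤-trans s>0 (m≤m+n s h))
      (<-≤-trans sh-small d≤d') Y.S-low-progression X.T-low-progression))
    (separated (X.T-high-≤ j≤e ≤-refl) (Y.S-high-> 1≤i' i'≤d' (+-monoʳ-≤ M 3e≤4e')))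
    where
    regroup : ∀ d s h → d + 2 * s + h + s ≡ d + 2 * s + (s + h)
    regroup = solve-∀

  U-S : ∀ {l i'} → 1 ≤ l → l ≤ e → 1 ≤ i' → i' ≤ d' → AtMostOneCommon (X.U l) (Y.S i')
  U-S 1≤l l≤e 1≤i' i'≤d' = AtMostOneCommon-++-highs (X.U-layered 1≤l l≤e) (Y.S-layered 1≤i' i'≤d')
    (Disjoint.sym (separated (Y.S-low-≤ i'≤d' ≤-refl) (X.U-low-> 1≤l 4kd'≤4kd+4ke)))
    (AtMostOneCommon-pairˡ λ U₁∈ → <⇒≱ (lookup (Y.S-high-> 1≤i' i'≤d' (+-monoʳ-≤ M 2e≤4e')) U₁∈) (X.U₁-≤ l≤e))
    where
    2e≤4e' : 2 * e ≤ 4 * e'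
    2e≤4e' = ≤-trans (*-monoˡ-≤ e (m≤m+n 2 1)) 3e≤4e'

  TU-TU : ∀ {P Q A B} → All (OnProgression P e (8 * k + 4)) A → All (OnProgression Q e' (8 * k + 4)) B →
    AtMostOneCommon A B
  TU-TU onA onB = AtMostOneCommon-sym
    (progressions-AtMostOneCommon refl s>0 (<-≤-trans s-small d≤e') onB onA)

  module _ {i i' j l j' l' : ℕ} (1≤i : 1 ≤ i) (i≤d : i ≤ d) (1≤i' : 1 ≤ i') (i'≤d' : i' ≤ d')
    (1≤j : 1 ≤ j) (j≤E : j ≤ Ehalf N d) (1≤l : 1 ≤ l) (l≤E : l ≤ Ehalf N d)
    (1≤j' : 1 ≤ j') (j'≤E' : j' ≤ Ehalf N d') (1≤l' : 1 ≤ l') (l'≤E' : l' ≤ Ehalf N d') where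

    Ehalf-d : Ehalf N d ≡ e
    Ehalf-d = Ehalf-exact d e N≡d+2e

    Ehalf-d' : Ehalf N d' ≡ e'
    Ehalf-d' = Ehalf-exact d' e' refl

    j≤e : j ≤ e
    j≤e = subst (j ≤_) Ehalf-d j≤E
    l≤e : l ≤ e
    l≤e = subst (l ≤_) Ehalf-d l≤E
    j'≤e' : j' ≤ e'
    j'≤e' = subst (j' ≤_) Ehalf-d' j'≤E'
    l'≤e' : l' ≤ e'
    l'≤e' = subst (l' ≤_) Ehalf-d' l'≤E'

    members-AtMostOneCommon : (f g : Fam) → ¬ (f ≡ SF × g ≡ SF × i ≡ i') →
      AtMostOneCommon (X.member f i j l) (Y.member g i' j' l')
    members-AtMostOneCommon SF SF ¬same = S-S 1≤i i≤d 1≤i' i'≤d' λ i≡i' → ¬same (refl , refl , i≡i')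
    members-AtMostOneCommon SF TF _ = S-T 1≤i i≤d 1≤j' j'≤e'
    members-AtMostOneCommon SF UF _ = S-U 1≤i i≤d 1≤l' l'≤e'
    members-AtMostOneCommon TF SF _ = T-S 1≤j j≤e 1≤i' i'≤d'
    members-AtMostOneCommon UF SF _ = U-S 1≤l l≤e 1≤i' i'≤d'
    members-AtMostOneCommon TF TF _ = TU-TU X.T-progression Y.T-progression
    members-AtMostOneCommon TF UF _ = TU-TU X.T-progression Y.U-progression
    members-AtMostOneCommon UF TF _ = TU-TU X.U-progression Y.T-progression
    members-AtMostOneCommon UF UF _ = TU-TU X.U-progression Y.U-progression

    conclusion : Conclusion k N d d' i i' j l j' l'
    conclusion = separate , common
      where
      separate : (f g : Fam) → ¬ (f ≡ SF × g ≡ SF × i ≡ i') →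
        AtMostOneCommon (pick k N d f i j l) (pick k N d' g i' j' l')
      separate f g ¬same = subst₂ AtMostOneCommon
        (sym (pick≡member {k} f i j l Ehalf-d)) (sym (pick≡member {k} g i' j' l' Ehalf-d'))
        (members-AtMostOneCommon f g ¬same)
      common : i ≡ i' → (a : ℕ) → (a ∈ Sset k N d i × a ∈ Sset k N d' i) ⇔ (a ≡ i ⊎ a ≡ mirror i)
      common _ a = subst₂ (λ A B → (a ∈ A × a ∈ B) ⇔ (a ≡ i ⊎ a ≡ mirror i))
        (sym (pick≡member {k} SF i j l Ehalf-d)) (sym (pick≡member {k} SF i j' l' Ehalf-d'))
        (S-S-common 1≤i i≤d)

conclusion-from-gaps : ∀ {k N d d' i i' j l j' l'} s h → 1 ≤ k → 0 < s →
  d' ≡ d + 2 * s → N ≡ d' + 2 * (d' + h) → N * (48 * k + 12) < 3 * d * (48 * k + 15) →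
  1 ≤ i → i ≤ d → 1 ≤ i' → i' ≤ d' → 1 ≤ j → j ≤ Ehalf N d → 1 ≤ l → l ≤ Ehalf N d →
  1 ≤ j' → j' ≤ Ehalf N d' → 1 ≤ l' → l' ≤ Ehalf N d' → Conclusion k N d d' i i' j l j' l'
conclusion-from-gaps {k} {d = d} s h k>0 s>0 refl refl lower =
  TwoDesigns.conclusion k d s h k>0 s>0 (lower-bound⇒ k d (3 * s + h)
    (subst (λ n → n * (48 * k + 12) < 3 * d * (48 * k + 15)) (regroup d s h) lower))
  where
  regroup : ∀ d s h → d + 2 * s + 2 * (d + 2 * s + h) ≡ 3 * d + 2 * (3 * s + h)
  regroup = solve-∀

conclusion-ordered : ∀ {k N d d' i i' j l j' l'} → 1 ≤ k → d < d' →
  d % 2 ≡ N % 2 → d' % 2 ≡ N % 2 → N * (48 * k + 12) < 3 * d * (48 * k + 15) → 3 * d' < N →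
  1 ≤ i → i ≤ d → 1 ≤ i' → i' ≤ d' → 1 ≤ j → j ≤ Ehalf N d → 1 ≤ l → l ≤ Ehalf N d →
  1 ≤ j' → j' ≤ Ehalf N d' → 1 ≤ l' → l' ≤ Ehalf N d' → Conclusion k N d d' i i' j l j' l'
conclusion-ordered {k} {N} {d} {d'} k>0 d<d' d≡N d'≡N lower upper
  with same-parity⇒+2* (trans d≡N (sym d'≡N)) (<⇒≤ d<d')
     | same-parity⇒+2* d'≡N (≤-trans (m≤m+n d' (2 * d')) (<⇒≤ upper))
... | s , d'≡ | e' , N≡ with m≤n⇒∃[o]m+o≡n (<⇒≤ d'<e')
  where
  d'<e' : d' < e'
  d'<e' = *-cancelˡ-< 2 d' e' (+-cancelˡ-< d' (2 * d') (2 * e') (subst (3 * d' <_) N≡ upper))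
... | h , refl = conclusion-from-gaps s h k>0 s>0 d'≡ N≡ lower
  where
  s>0 : 0 < s
  s>0 = n≢0⇒n>0 λ { refl → <-irrefl (sym (trans d'≡ (+-identityʳ d))) d<d' }

lemma17 : (k N d d' : ℕ) → 1 ≤ k → 1 ≤ N → d ≢ d' →
    d % 2 ≡ N % 2 → d' % 2 ≡ N % 2 →
    -- N/3 - N/(48k+15) < d < N/3, cleared of denominators
    N * (48 * k + 12) < 3 * d * (48 * k + 15) → 3 * d < N →
    N * (48 * k + 12) < 3 * d' * (48 * k + 15) → 3 * d' < N →
    (i i' j l j' l' : ℕ) →
    1 ≤ i → i ≤ d → 1 ≤ i' → i' ≤ d' →
    1 ≤ j → j ≤ Ehalf N d → 1 ≤ l → l ≤ Ehalf N d →
    1 ≤ j' → j' ≤ Ehalf N d' → 1 ≤ l' → l' ≤ Ehalf N d' →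
    ((f g : Fam) → ¬ (f ≡ SF × g ≡ SF × i ≡ i') →
      AtMostOneCommon (pick k N d f i j l) (pick k N d' g i' j' l'))
    × (i ≡ i' → (a : ℕ) →
      ((a ∈ Sset k N d i × a ∈ Sset k N d' i) ⇔ (a ≡ i ⊎ a ≡ ((4 * k + 2) * N ∸ i) + 1)))
lemma17 k N d d' k>0 _ d≢d' d≡N d'≡N lower upper lower' upper' i i' j l j' l'
  1≤i i≤d 1≤i' i'≤d' 1≤j j≤E 1≤l l≤E 1≤j' j'≤E' 1≤l' l'≤E' with <-cmp d d'
... | tri< d<d' _ _ = conclusion-ordered k>0 d<d' d≡N d'≡N lower upper'
  1≤i i≤d 1≤i' i'≤d' 1≤j j≤E 1≤l l≤E 1≤j' j'≤E' 1≤l' l'≤E'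
... | tri≈ _ d≡d' _ = contradiction d≡d' d≢d'
... | tri> _ _ d'<d = Conclusion-swap (conclusion-ordered k>0 d'<d d'≡N d≡N lower' upper
  1≤i' i'≤d' 1≤i i≤d 1≤j' j'≤E' 1≤l' l'≤E' 1≤j j≤E 1≤l l≤E)
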